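{- Let $m,n>2$ be integers and let $G$ be the graph obtained from disjoint copies of the complete graphs $K_n$ and $K_m$ by joining them with a path of length $1$ (an edge between a vertex of $K_n$ and a vertex of $K_m$) or a path of length $2$ (a new vertex adjacent to one vertex of $K_n$ and one vertex of $K_m$). Then $\gamma_{ct}(G)=\gamma'(G)$ if and only if $m$ or $n$ is even.
   Context: Two distinct edges are adjacent if they share a vertex. For a graph $G=(V,E)$, a set $F\subseteq E$ is an edge dominating set if every edge not in $F$ is adjacent to some edge of $F$; $\gamma'(G)$ is the minimum cardinality of an edge dominating set. An edge dominating set $F$ is an edge cut dominating set if the spanning subgraph $(V,E\setminus F)$ is disconnected; $\gamma_{ct}(G)$ is the minimum cardinality of an edge cut dominating set. -}

module Defs where

open import Data.Nat using (ℕ; suc; _+_; _≤_; _<ᵇ_)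
open import Data.Bool using (if_then_else_)
open import Data.Fin using (Fin; zero; toℕ; _↑ˡ_; _↑ʳ_)
open import Data.Fin.Subset using (Subset; _∈_; _∉_; ∣_∣)
open import Data.List using (List; []; _∷_; [_]; _++_; map; concatMap; allFin; length; lookup)
open import Data.Product using (_×_; _,_; proj₁; proj₂; Σ; ∃; ∃-syntax)
open import Data.Sum using (_⊎_)
open import Relation.Binary.PropositionalEquality using (_≡_; _≢_)
open import Relation.Nullary using (¬_)

-- A finite (multi)graph: vertices Fin nV, edges given by a list of endpoint pairs;
-- edge i (i : Fin (length edges)) has endpoints lookup edges i.
record Graph : Set where
  field
    nV    : ℕ
    edges : List (Fin nV × Fin nV)

open Graph public

Vertex : Graph → Set
Vertex G = Fin (nV G)

Edge : Graph → Set
Edge G = Fin (length (edges G))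

endpoints : (G : Graph) → Edge G → Vertex G × Vertex G
endpoints G e = lookup (edges G) e

Incident : (G : Graph) → Vertex G → Edge G → Set
Incident G v e = (v ≡ proj₁ (endpoints G e)) ⊎ (v ≡ proj₂ (endpoints G e))

Adjacent : (G : Graph) → Edge G → Edge G → Set
Adjacent G e f = (e ≢ f) × (∃[ v ] (Incident G v e × Incident G v f))

EdgeSet : Graph → Set
EdgeSet G = Subset (length (edges G))

IsEdgeDominating : (G : Graph) → EdgeSet G → Set
IsEdgeDominating G F = (e : Edge G) → e ∉ F → ∃[ f ] ((f ∈ F) × Adjacent G e f)

-- reachability in the spanning subgraph (V , E ∖ F)
data Reach (G : Graph) (F : EdgeSet G) : Vertex G → Vertex G → Set where
  here : (v : Vertex G) → Reach G F v v
  step : (u : Vertex G) {w : Vertex G} (e : Edge G) → e ∉ F →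
         ((endpoints G e ≡ (u , w)) ⊎ (endpoints G e ≡ (w , u))) →
         {v : Vertex G} → Reach G F w v → Reach G F u v

RemovalDisconnects : (G : Graph) → EdgeSet G → Set
RemovalDisconnects G F = ∃[ u ] ∃[ v ] (¬ Reach G F u v)

IsEdgeCutDominating : (G : Graph) → EdgeSet G → Set
IsEdgeCutDominating G F = IsEdgeDominating G F × RemovalDisconnects G F

IsMinCard : (G : Graph) → (EdgeSet G → Set) → ℕ → Set
IsMinCard G P k = (∃[ F ] (P F × (∣ F ∣ ≡ k))) × ((F : EdgeSet G) → P F → k ≤ ∣ F ∣)

IsEdgeDominationNumber : Graph → ℕ → Set
IsEdgeDominationNumber G k = IsMinCard G (IsEdgeDominating G) k

IsEdgeCutDominationNumber : Graph → ℕ → Set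
IsEdgeCutDominationNumber G k = IsMinCard G (IsEdgeCutDominating G) k

cliqueEdges : (k : ℕ) → List (Fin k × Fin k)
cliqueEdges k =
  concatMap (λ i → concatMap (λ j → if toℕ i <ᵇ toℕ j then [ (i , j) ] else []) (allFin k)) (allFin k)

twoCliqueEdges : (n m : ℕ) → List (Fin (n + m) × Fin (n + m))
twoCliqueEdges n m =
  map (λ p → (proj₁ p ↑ˡ m , proj₂ p ↑ˡ m)) (cliqueEdges n) ++
  map (λ p → (n ↑ʳ proj₁ p , n ↑ʳ proj₂ p)) (cliqueEdges m)

joinPath1 : (n m : ℕ) → Fin n → Fin m → Graph
joinPath1 n m a b = record
  { nV = n + m
  ; edges = twoCliqueEdges n m ++ [ (a ↑ˡ m , n ↑ʳ b) ] }

joinPath2 : (n m : ℕ) → Fin n → Fin m → Graph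
joinPath2 n m a b = record
  { nV = n + m + 1
  ; edges = map (λ p → (proj₁ p ↑ˡ 1 , proj₂ p ↑ˡ 1)) (twoCliqueEdges n m) ++
            ((a ↑ˡ m) ↑ˡ 1 , c) ∷ ((n ↑ʳ b) ↑ˡ 1 , c) ∷ [] }
  where
  c : Fin (n + m + 1)
  c = (n + m) ↑ʳ zero

data PathLength : Set where
  len1 len2 : PathLength

joinGraph : PathLength → (n m : ℕ) → Fin n → Fin m → Graph
joinGraph len1 = joinPath1
joinGraph len2 = joinPath2

-- Every edge dominating set F leaves at most one vertex of each clique uncovered. An edge of K_k covers two of
-- its vertices and a connecting edge only its end in K_k, so k ≤ 1 + 2·|F ∩ E(K_k)| + |F ∩ {connecting edge at K_k}|.
-- If n = 2p + 1 and m = 2q + 1, near-perfect matchings of the two cliques through a and b dominate G with p + q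
-- edges. A dominating F whose removal disconnects G has at least p + q + 1 edges: either it contains a connecting
-- edge, or some clique K_k has two vertices u, w separated by F, and then every other vertex of K_k is joined by an
-- edge of F to u or to w, which gives 2p (or 2q) edges of F inside that clique.
-- If n is even, the connecting edge at a together with near-perfect matchings of K_n − a and of K_m (of K_m − b for
-- the path of length 1, whose single edge also covers b) is a minimum edge dominating set, and removing it cuts K_n
-- off from the rest of G.

module Submission where

open import Defs
open import Data.Bool using (true; false; if_then_else_)
import Data.Bool as Bool
open import Data.Empty using (⊥-elim)
open import Data.Fin using (Fin; zero; suc; toℕ; punchIn; splitAt; _↑ˡ_; _↑ʳ_) renaming (_≟_ to _≟ᶠ_)
import Data.Fin.Properties as Finₚ
open Finₚ
  using (punchInᵢ≢i; toℕ-injective; ↑ˡ-injective; ↑ʳ-injective; splitAt-↑ˡ; splitAt-↑ʳ; splitAt⁻¹-↑ˡ; splitAt⁻¹-↑ʳ)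
open import Data.Fin.Subset using (Subset; _∈_; _∉_; ∣_∣; _∪_; _∩_; ∁; ⁅_⁆; ⊥; _⊆_; _-_)
open import Data.Fin.Subset.Properties
open import Data.List using (List; []; _∷_; [_]; _++_; map; allFin; length; lookup; filter)
open import Data.List.Membership.Propositional using () renaming (_∈_ to _∈ₗ_)
open import Data.List.Membership.Propositional.Properties
  using (∈-allFin; ∈-map⁺; ∈-++⁺ˡ; ∈-++⁺ʳ; ∈-concatMap⁺; ∈-lookup; ∈-filter⁺; ∈-filter⁻)
open import Data.List.Properties
  using (map-id; filter-++; filter-none; filter-some; filter-notAll; length-filter; length-tabulate; length-++)
open import Data.List.Relation.Unary.All using (All; []; _∷_; universal)
import Data.List.Relation.Unary.All as All
open import Data.List.Relation.Unary.All.Properties using (concat⁺; map⁺; ++⁺)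
open import Data.List.Relation.Unary.AllPairs using (AllPairs; _∷_)
open import Data.List.Relation.Unary.Any using (Any; here; there)
import Data.List.Relation.Unary.Any as Any
import Data.List.Relation.Unary.Any.Properties as Anyₚ
import Data.List.Relation.Unary.Unique.Propositional.Properties as Uniqueₚ
open import Data.Nat using (ℕ; zero; suc; _+_; _*_; _∸_; _≤_; _<_; _≤?_; _<ᵇ_; z≤n; s≤s; s≤s⁻¹)
open import Data.Nat.Divisibility using (_∣_; divides)
open import Data.Nat.Properties
open import Data.Nat.Tactic.RingSolver using (solve-∀)
open import Data.Product using (_×_; _,_; proj₁; proj₂; ∃; ∃-syntax)
import Data.Product as Product
open import Data.Product.Properties using (≡-dec)
open import Data.Sum using (_⊎_; inj₁; inj₂)
import Data.Sum as Sum
open import Data.Unit using (⊤; tt)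
open import Data.Vec using (_∷_; []; here; there; tabulate)
open import Data.Vec.Properties using ([]=⇒lookup; lookup⇒[]=; lookup∘tabulate)
open import Function using (_∘_; const; id)
open import Function.Bundles using (_⇔_; mk⇔)
open import Level using (0ℓ)
open import Relation.Binary.Definitions using (tri<; tri≈; tri>)
open import Relation.Binary.PropositionalEquality hiding ([_])
open import Relation.Nullary using (Dec; yes; no; does; ¬_)
open import Relation.Nullary.Decidable using (_×-dec_; _⊎-dec_; ¬?)
open import Relation.Unary using (Pred; Decidable)

private variable
  k : ℕ

-- Counting subsets of Fin k

Disjoint : Subset k → Subset k → Set
Disjoint p q = ∀ {x} → x ∈ p → x ∉ q

∣p∪q∣≤∣p∣+∣q∣ : (p q : Subset k) → ∣ p ∪ q ∣ ≤ ∣ p ∣ + ∣ q ∣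
∣p∪q∣≤∣p∣+∣q∣ []          []          = z≤n
∣p∪q∣≤∣p∣+∣q∣ (true ∷ p)  (b ∷ q)     =
  s≤s (≤-trans (∣p∪q∣≤∣p∣+∣q∣ p q) (+-monoʳ-≤ ∣ p ∣ (∣p∣≤∣x∷p∣ b q)))
∣p∪q∣≤∣p∣+∣q∣ (false ∷ p) (true ∷ q)  rewrite +-suc ∣ p ∣ ∣ q ∣ = s≤s (∣p∪q∣≤∣p∣+∣q∣ p q)
∣p∪q∣≤∣p∣+∣q∣ (false ∷ p) (false ∷ q) = ∣p∪q∣≤∣p∣+∣q∣ p q

Disjoint⇒∣p∣+∣q∣≤∣p∪q∣ : (p q : Subset k) → Disjoint p q → ∣ p ∣ + ∣ q ∣ ≤ ∣ p ∪ q ∣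
Disjoint⇒∣p∣+∣q∣≤∣p∪q∣ []          []          _ = z≤n
Disjoint⇒∣p∣+∣q∣≤∣p∪q∣ (true ∷ p)  (true ∷ q)  d = ⊥-elim (d here here)
Disjoint⇒∣p∣+∣q∣≤∣p∪q∣ (true ∷ p)  (false ∷ q) d =
  s≤s (Disjoint⇒∣p∣+∣q∣≤∣p∪q∣ p q λ x∈p x∈q → d (there x∈p) (there x∈q))
Disjoint⇒∣p∣+∣q∣≤∣p∪q∣ (false ∷ p) (true ∷ q)  d rewrite +-suc ∣ p ∣ ∣ q ∣ =
  s≤s (Disjoint⇒∣p∣+∣q∣≤∣p∪q∣ p q λ x∈p x∈q → d (there x∈p) (there x∈q))
Disjoint⇒∣p∣+∣q∣≤∣p∪q∣ (false ∷ p) (false ∷ q) d =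
  Disjoint⇒∣p∣+∣q∣≤∣p∪q∣ p q λ x∈p x∈q → d (there x∈p) (there x∈q)

x∈p⇒0<∣p∣ : {p : Subset k} {x : Fin k} → x ∈ p → 0 < ∣ p ∣
x∈p⇒0<∣p∣ {p = true ∷ p}  _           = s≤s z≤n
x∈p⇒0<∣p∣ {p = false ∷ p} (there x∈p) = x∈p⇒0<∣p∣ x∈p

Subsingleton : Subset k → Set
Subsingleton p = ∀ {x y} → x ∈ p → y ∈ p → x ≡ y

Subsingleton⇒∣p∣≤1 : (p : Subset k) → Subsingleton p → ∣ p ∣ ≤ 1
Subsingleton⇒∣p∣≤1 []                 _ = z≤n
Subsingleton⇒∣p∣≤1 {suc k} (true ∷ p) s = s≤s (≤-reflexive (begin
  ∣ p ∣ ≡⟨ cong ∣_∣ (Empty-unique λ (x , x∈p) → Finₚ.0≢1+n (s here (there x∈p))) ⟩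
  ∣ ⊥ {k} ∣ ≡⟨ ∣⊥∣≡0 k ⟩
  0         ∎))
  where open ≡-Reasoning
Subsingleton⇒∣p∣≤1 (false ∷ p)        s =
  Subsingleton⇒∣p∣≤1 p λ x∈p y∈p → Finₚ.suc-injective (s (there x∈p) (there y∈p))

injectiveRelation⇒∣p∣≤∣q∣ : ∀ {l} (p : Subset k) (q : Subset l) (R : Fin k → Fin l → Set) →
  (∀ {x} → x ∈ p → ∃[ y ] (y ∈ q × R x y)) →
  (∀ {x x′ y} → x ∈ p → x′ ∈ p → R x y → R x′ y → x ≡ x′) →
  ∣ p ∣ ≤ ∣ q ∣
injectiveRelation⇒∣p∣≤∣q∣ []          q R total inj = z≤n
injectiveRelation⇒∣p∣≤∣q∣ (false ∷ p) q R total inj =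
  injectiveRelation⇒∣p∣≤∣q∣ p q (R ∘ suc) (total ∘ there)
    (λ x∈p x′∈p r r′ → Finₚ.suc-injective (inj (there x∈p) (there x′∈p) r r′))
injectiveRelation⇒∣p∣≤∣q∣ (true ∷ p)  q R total inj with total here
... | y₀ , y₀∈q , r₀ = ≤-trans (s≤s ∣p∣≤∣q-y₀∣) (x∈p⇒∣p-x∣<∣p∣ y₀∈q)
  where
  total′ : ∀ {x} → x ∈ p → ∃[ y ] (y ∈ q - y₀ × R (suc x) y)
  total′ x∈p with total (there x∈p)
  ... | y , y∈q , r = y , x∈p∧x≢y⇒x∈p-y y∈q (λ { refl → Finₚ.0≢1+n (inj here (there x∈p) r₀ r) }) , r
  ∣p∣≤∣q-y₀∣ : ∣ p ∣ ≤ ∣ q - y₀ ∣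
  ∣p∣≤∣q-y₀∣ = injectiveRelation⇒∣p∣≤∣q∣ p (q - y₀) (R ∘ suc) total′
    (λ x∈p x′∈p r r′ → Finₚ.suc-injective (inj (there x∈p) (there x′∈p) r r′))

⋃[_∈_] : ∀ {l} → (Fin l → Subset k) → Subset l → Subset k
⋃[ f ∈ [] ]        = ⊥
⋃[ f ∈ true ∷ p ]  = f zero ∪ ⋃[ f ∘ suc ∈ p ]
⋃[ f ∈ false ∷ p ] = ⋃[ f ∘ suc ∈ p ]

x∈⋃ : ∀ {l} (f : Fin l → Subset k) (p : Subset l) {i x} → i ∈ p → x ∈ f i → x ∈ ⋃[ f ∈ p ]
x∈⋃ f (true ∷ p)  here        x∈fi = x∈p∪q⁺ (inj₁ x∈fi)
x∈⋃ f (true ∷ p)  (there i∈p) x∈fi = x∈p∪q⁺ (inj₂ (x∈⋃ (f ∘ suc) p i∈p x∈fi))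
x∈⋃ f (false ∷ p) (there i∈p) x∈fi = x∈⋃ (f ∘ suc) p i∈p x∈fi

∣⋃∣≤ : ∀ {l} (f : Fin l → Subset k) (p : Subset l) (c : ℕ) → (∀ i → ∣ f i ∣ ≤ c) →
       ∣ ⋃[ f ∈ p ] ∣ ≤ c * ∣ p ∣
∣⋃∣≤ {k} f []          c bound = ≤-trans (≤-reflexive (∣⊥∣≡0 k)) z≤n
∣⋃∣≤     f (true ∷ p)  c bound = begin
  ∣ f zero ∪ ⋃[ f ∘ suc ∈ p ] ∣      ≤⟨ ∣p∪q∣≤∣p∣+∣q∣ (f zero) _ ⟩
  ∣ f zero ∣ + ∣ ⋃[ f ∘ suc ∈ p ] ∣  ≤⟨ +-mono-≤ (bound zero) (∣⋃∣≤ (f ∘ suc) p c (bound ∘ suc)) ⟩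
  c + c * ∣ p ∣                       ≡⟨ *-suc c ∣ p ∣ ⟨
  c * suc ∣ p ∣                       ∎
  where open ≤-Reasoning
∣⋃∣≤     f (false ∷ p) c bound = ∣⋃∣≤ (f ∘ suc) p c (bound ∘ suc)

subsetOf : {P : Pred (Fin k) 0ℓ} → Decidable P → Subset k
subsetOf P? = tabulate (does ∘ P?)

module _ {P : Pred (Fin k) 0ℓ} (P? : Decidable P) where

  ∈-subsetOf⁺ : ∀ {x} → P x → x ∈ subsetOf P?
  ∈-subsetOf⁺ {x} px with P? x in eq
  ... | yes _ = lookup⇒[]= x _ (trans (lookup∘tabulate _ x) (cong does eq))
  ... | no ¬px = ⊥-elim (¬px px)

  ∈-subsetOf⁻ : ∀ {x} → x ∈ subsetOf P? → P x
  ∈-subsetOf⁻ {x} x∈ with P? x in eq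
  ... | yes px = px
  ... | no _ with () ← trans (sym ([]=⇒lookup x∈)) (trans (lookup∘tabulate _ x) (cong does eq))

fromList : List (Fin k) → Subset k
fromList []       = ⊥
fromList (x ∷ xs) = ⁅ x ⁆ ∪ fromList xs

∣fromList∣≤length : (xs : List (Fin k)) → ∣ fromList xs ∣ ≤ length xs
∣fromList∣≤length {k} []       = ≤-reflexive (∣⊥∣≡0 k)
∣fromList∣≤length     (x ∷ xs) = begin
  ∣ ⁅ x ⁆ ∪ fromList xs ∣        ≤⟨ ∣p∪q∣≤∣p∣+∣q∣ ⁅ x ⁆ (fromList xs) ⟩
  ∣ ⁅ x ⁆ ∣ + ∣ fromList xs ∣    ≡⟨ cong (_+ ∣ fromList xs ∣) (∣⁅x⁆∣≡1 x) ⟩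
  suc ∣ fromList xs ∣            ≤⟨ s≤s (∣fromList∣≤length xs) ⟩
  suc (length xs)                ∎
  where open ≤-Reasoning

Any⇒∃∈fromList : {P : Pred (Fin k) 0ℓ} {xs : List (Fin k)} → Any P xs → ∃[ x ] (x ∈ fromList xs × P x)
Any⇒∃∈fromList (here px)   = _ , x∈p∪q⁺ (inj₁ (x∈⁅x⁆ _)) , px
Any⇒∃∈fromList (there pxs) with Any⇒∃∈fromList pxs
... | x , x∈ , px = x , x∈p∪q⁺ (inj₂ x∈) , px

∩-monoʳ-⊆ : (p : Subset k) {q r : Subset k} → q ⊆ r → p ∩ q ⊆ p ∩ r
∩-monoʳ-⊆ p {q} q⊆r x∈p∩q = let x∈p , x∈q = x∈p∩q⁻ p q x∈p∩q in x∈p∩q⁺ (x∈p , q⊆r x∈q)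

∣p∣+∣∁p∣≡n : (p : Subset k) → ∣ p ∣ + ∣ ∁ p ∣ ≡ k
∣p∣+∣∁p∣≡n p = trans (cong (∣ p ∣ +_) (∣∁p∣≡n∸∣p∣ p)) (m+[n∸m]≡n (∣p∣≤n p))

Disjoint⇒∣r∩p∣+∣r∩q∣≤∣r∩[p∪q]∣ : (r p q : Subset k) → Disjoint p q →
                                  ∣ r ∩ p ∣ + ∣ r ∩ q ∣ ≤ ∣ r ∩ (p ∪ q) ∣
Disjoint⇒∣r∩p∣+∣r∩q∣≤∣r∩[p∪q]∣ r p q p#q = begin
  ∣ r ∩ p ∣ + ∣ r ∩ q ∣     ≤⟨ Disjoint⇒∣p∣+∣q∣≤∣p∪q∣ (r ∩ p) (r ∩ q) r∩p#r∩q ⟩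
  ∣ r ∩ p ∪ r ∩ q ∣         ≡⟨ cong ∣_∣ (∩-distribˡ-∪ r p q) ⟨
  ∣ r ∩ (p ∪ q) ∣           ∎
  where
  open ≤-Reasoning
  r∩p#r∩q : Disjoint (r ∩ p) (r ∩ q)
  r∩p#r∩q x∈r∩p x∈r∩q = p#q (proj₂ (x∈p∩q⁻ r p x∈r∩p)) (proj₂ (x∈p∩q⁻ r q x∈r∩q))

-- Halving inequalities

2*m≤1+2*n⇒m≤n : ∀ m n → 2 * m ≤ suc (2 * n) → m ≤ n
2*m≤1+2*n⇒m≤n m n 2m≤1+2n =
  s≤s⁻¹ (*-cancelˡ-< 2 m (suc n) (subst (suc (2 * m) ≤_) (sym (*-suc 2 n)) (s≤s 2m≤1+2n)))

2*m≤1+2*n+z⇒m≤n+z : ∀ m n z → 2 * m ≤ suc (2 * n + z) → m ≤ n + z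
2*m≤1+2*n+z⇒m≤n+z m n z 2m≤ = 2*m≤1+2*n⇒m≤n m (n + z) (≤-trans 2m≤ (s≤s (begin
  2 * n + z          ≤⟨ +-monoʳ-≤ (2 * n) (m≤n*m z 2) ⟩
  2 * n + 2 * z      ≡⟨ *-distribˡ-+ 2 n z ⟨
  2 * (n + z)        ∎)))
  where open ≤-Reasoning

-- lS, lT are matching sizes; a, b count edges inside the cliques and x, zS, zT connecting edges.
sharedExitBound : ∀ lS lT P m a b x → lS < P → 2 * lT < m →
                  2 * P ≤ suc (2 * a + x) → m ≤ suc (2 * b + x) → suc (lS + lT) ≤ a + b + x
sharedExitBound lS lT P m a b x lS<P 2lT<m boundS boundT = 2*m≤1+2*n⇒m≤n (suc (lS + lT)) (a + b + x) (s≤s⁻¹ (begin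
  suc (2 * suc (lS + lT))            ≡⟨ regroupˡ lS lT ⟩
  2 * suc lS + suc (2 * lT)          ≤⟨ +-mono-≤ (*-monoʳ-≤ 2 lS<P) 2lT<m ⟩
  2 * P + m                          ≤⟨ +-mono-≤ boundS boundT ⟩
  suc (2 * a + x) + suc (2 * b + x)  ≡⟨ regroupʳ a b x ⟩
  suc (suc (2 * (a + b + x)))        ∎))
  where
  open ≤-Reasoning
  regroupˡ : ∀ l l′ → suc (2 * suc (l + l′)) ≡ 2 * suc l + suc (2 * l′)
  regroupˡ = solve-∀
  regroupʳ : ∀ a b x → suc (2 * a + x) + suc (2 * b + x) ≡ suc (suc (2 * (a + b + x)))
  regroupʳ = solve-∀

separateExitsBound : ∀ lS lT P m a b zS zT → lS < P → 2 * lT ≤ m →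
                     2 * P ≤ suc (2 * a + zS) → m ≤ suc (2 * b + zT) → suc (lS + lT) ≤ a + b + (zS + zT)
separateExitsBound lS lT P m a b zS zT lS<P 2lT≤m boundS boundT = begin
  suc lS + lT              ≤⟨ +-mono-≤ lS<P (2*m≤1+2*n+z⇒m≤n+z lT b zT (≤-trans 2lT≤m boundT)) ⟩
  P + (b + zT)             ≤⟨ +-monoˡ-≤ (b + zT) (2*m≤1+2*n+z⇒m≤n+z P a zS boundS) ⟩
  a + zS + (b + zT)        ≡⟨ regroup a b zS zT ⟩
  a + b + (zS + zT)        ∎
  where
  open ≤-Reasoning
  regroup : ∀ a b zS zT → a + zS + (b + zT) ≡ a + b + (zS + zT)
  regroup = solve-∀

1≤p⇒1+p≤2*p : ∀ {p} → 1 ≤ p → suc p ≤ 2 * p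
1≤p⇒1+p≤2*p {p} 1≤p = ≤-trans (+-monoˡ-≤ p 1≤p) (≤-reflexive (cong (p +_) (sym (+-identityʳ p))))

even⊎odd : ∀ n → 2 ∣ n ⊎ ∃[ p ] n ≡ suc (2 * p)
even⊎odd zero    = inj₁ (divides 0 refl)
even⊎odd (suc n) with even⊎odd n
... | inj₁ (divides q n≡q*2) = inj₂ (q , cong suc (trans n≡q*2 (*-comm q 2)))
... | inj₂ (p , n≡1+2p)      = inj₁ (divides (suc p) (cong suc (trans n≡1+2p (cong suc (*-comm 2 p)))))

odd>2⇒1≤half : ∀ {n p} → n ≡ suc (2 * p) → 2 < n → 1 ≤ p
odd>2⇒1≤half {p = zero}  refl (s≤s ())
odd>2⇒1≤half {p = suc _} _    _ = s≤s z≤n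

-- Covering, domination and reachability

module _ (G : Graph) where

  Joins : Edge G → Vertex G → Vertex G → Set
  Joins e u w = (endpoints G e ≡ (u , w)) ⊎ (endpoints G e ≡ (w , u))

  joins-sym : ∀ {e u w} → Joins e u w → Joins e w u
  joins-sym (inj₁ eq) = inj₂ eq
  joins-sym (inj₂ eq) = inj₁ eq

  joins⇒incidentˡ : ∀ {e u w} → Joins e u w → Incident G u e
  joins⇒incidentˡ (inj₁ eq) = inj₁ (sym (cong proj₁ eq))
  joins⇒incidentˡ (inj₂ eq) = inj₂ (sym (cong proj₂ eq))

  joins⇒incidentʳ : ∀ {e u w} → Joins e u w → Incident G w e
  joins⇒incidentʳ = joins⇒incidentˡ ∘ joins-sym

  incident⇒endpoint : ∀ {e u w v} → Joins e u w → Incident G v e → v ≡ u ⊎ v ≡ w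
  incident⇒endpoint (inj₁ eq) (inj₁ v≡) = inj₁ (trans v≡ (cong proj₁ eq))
  incident⇒endpoint (inj₁ eq) (inj₂ v≡) = inj₂ (trans v≡ (cong proj₂ eq))
  incident⇒endpoint (inj₂ eq) (inj₁ v≡) = inj₂ (trans v≡ (cong proj₁ eq))
  incident⇒endpoint (inj₂ eq) (inj₂ v≡) = inj₁ (trans v≡ (cong proj₂ eq))

  incident? : ∀ v e → Dec (Incident G v e)
  incident? v e = (v ≟ᶠ proj₁ (endpoints G e)) ⊎-dec (v ≟ᶠ proj₂ (endpoints G e))

  Covers : EdgeSet G → Vertex G → Set
  Covers F v = ∃[ e ] (e ∈ F × Incident G v e)

  covers? : ∀ F v → Dec (Covers F v)
  covers? F v = Finₚ.any? (λ e → (e ∈? F) ×-dec incident? v e)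

  endpointCovered⇒dominating : (F : EdgeSet G) →
    (∀ e → e ∉ F → Covers F (proj₁ (endpoints G e)) ⊎ Covers F (proj₂ (endpoints G e))) →
    IsEdgeDominating G F
  endpointCovered⇒dominating F covered e e∉F with covered e e∉F
  ... | inj₁ (f , f∈F , inc) = f , f∈F , (λ { refl → e∉F f∈F }) , _ , inj₁ refl , inc
  ... | inj₂ (f , f∈F , inc) = f , f∈F , (λ { refl → e∉F f∈F }) , _ , inj₂ refl , inc

  reach-trans : ∀ {F u v w} → Reach G F u v → Reach G F v w → Reach G F u w
  reach-trans (here _)               r = r
  reach-trans (step u e e∉F joins p) r = step u e e∉F joins (reach-trans p r)

  joins⇒reach : ∀ {F e u w} → e ∉ F → Joins e u w → Reach G F u w
  joins⇒reach {u = u} {w} e∉F joins = step u _ e∉F joins (here w)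

  reach-sym : ∀ {F u v} → Reach G F u v → Reach G F v u
  reach-sym (here _)               = here _
  reach-sym (step u e e∉F joins p) = reach-trans (reach-sym p) (joins⇒reach e∉F (joins-sym joins))

  joins⇒coversEndpoint : ∀ {F e u w} → Joins e u w → Covers F u →
                         Covers F (proj₁ (endpoints G e)) ⊎ Covers F (proj₂ (endpoints G e))
  joins⇒coversEndpoint (inj₁ refl) cu = inj₁ cu
  joins⇒coversEndpoint (inj₂ refl) cu = inj₂ cu

  IsMinimumDominatingCut : EdgeSet G → Set
  IsMinimumDominatingCut F₀ = IsEdgeCutDominating G F₀ × (∀ F → IsEdgeDominating G F → ∣ F₀ ∣ ≤ ∣ F ∣)

  Touches : List (Edge G) → Vertex G → Set
  Touches es v = Any (Incident G v) es

  touches⇒covers : ∀ es {v} → Touches es v → Covers (fromList es) v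
  touches⇒covers _ = Any⇒∃∈fromList

  -- Cliques attached by one edge

  -- In the theorem: K_n with root a, and exit b (path of length 1) or the middle vertex of the path (length 2).
  record AttachedClique : Set where
    field
      size             : ℕ
      vertex           : Fin size → Vertex G
      vertex-injective : ∀ {i j} → vertex i ≡ vertex j → i ≡ j
      clique           : ∀ {i j} → i ≢ j → ∃[ e ] Joins e (vertex i) (vertex j)
      root             : Fin size
      exit             : Vertex G
      exit-outside     : ∀ i → vertex i ≢ exit
      exitEdge         : Edge G
      exitEdge-joins   : Joins exitEdge (vertex root) exit
      exitEdge-unique  : ∀ {e} → Joins e (vertex root) exit → e ≡ exitEdge

  module AttachedCliqueProperties (S : AttachedClique) where
    open AttachedClique S public

    InClique : Vertex G → Set
    InClique v = ∃[ i ] vertex i ≡ v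

    inClique? : ∀ v → Dec (InClique v)
    inClique? v = Finₚ.any? (λ i → vertex i ≟ᶠ v)

    Internal : Edge G → Set
    Internal e = InClique (proj₁ (endpoints G e)) × InClique (proj₂ (endpoints G e))

    internal? : ∀ e → Dec (Internal e)
    internal? e = inClique? _ ×-dec inClique? _

    internalEdges : EdgeSet G
    internalEdges = subsetOf internal?

    joins⇒internal : ∀ {e i j} → Joins e (vertex i) (vertex j) → e ∈ internalEdges
    joins⇒internal {i = i} {j} (inj₁ eq) =
      ∈-subsetOf⁺ internal? ((i , sym (cong proj₁ eq)) , (j , sym (cong proj₂ eq)))
    joins⇒internal {i = i} {j} (inj₂ eq) =
      ∈-subsetOf⁺ internal? ((j , sym (cong proj₁ eq)) , (i , sym (cong proj₂ eq)))

    incident-internal⇒InClique : ∀ {e v} → Internal e → Incident G v e → InClique v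
    incident-internal⇒InClique (inFst , _) (inj₁ refl) = inFst
    incident-internal⇒InClique (_ , inSnd) (inj₂ refl) = inSnd

    CliqueEdge : Edge G → Set
    CliqueEdge e = ∃[ i ] ∃[ j ] (i ≢ j × endpoints G e ≡ (vertex i , vertex j))

    Boundary : Set
    Boundary = ∀ e i → Incident G (vertex i) e → Internal e ⊎ e ≡ exitEdge

    AtMostOneUncovered : EdgeSet G → Set
    AtMostOneUncovered F = ∀ {i j} → ¬ Covers F (vertex i) → ¬ Covers F (vertex j) → i ≡ j

    dominating⇒AtMostOneUncovered : ∀ {F} → IsEdgeDominating G F → AtMostOneUncovered F
    dominating⇒AtMostOneUncovered {F} dom {i} {j} ¬ci ¬cj with i ≟ᶠ j
    ... | yes i≡j = i≡j
    ... | no i≢j with clique i≢j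
    ... | e , joins with e ∈? F
    ... | yes e∈F = ⊥-elim (¬ci (e , e∈F , joins⇒incidentˡ joins))
    ... | no e∉F with dom e e∉F
    ... | f , f∈F , _ , v , v∈e , v∈f with incident⇒endpoint joins v∈e
    ... | inj₁ refl = ⊥-elim (¬ci (f , f∈F , v∈f))
    ... | inj₂ refl = ⊥-elim (¬cj (f , f∈F , v∈f))

    vertex≟ : ∀ v i → Dec (vertex i ≡ v)
    vertex≟ v i = vertex i ≟ᶠ v

    fiber : Vertex G → Subset size
    fiber v = subsetOf (vertex≟ v)

    ∣fiber∣≤1 : ∀ v → ∣ fiber v ∣ ≤ 1
    ∣fiber∣≤1 v = Subsingleton⇒∣p∣≤1 (fiber v) λ i∈ j∈ →
      vertex-injective (trans (∈-subsetOf⁻ (vertex≟ v) i∈) (sym (∈-subsetOf⁻ (vertex≟ v) j∈)))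

    incidentVertices : Edge G → Subset size
    incidentVertices e = fiber (proj₁ (endpoints G e)) ∪ fiber (proj₂ (endpoints G e))

    ∣incidentVertices∣≤2 : ∀ e → ∣ incidentVertices e ∣ ≤ 2
    ∣incidentVertices∣≤2 e =
      ≤-trans (∣p∪q∣≤∣p∣+∣q∣ (fiber _) (fiber _)) (+-mono-≤ (∣fiber∣≤1 _) (∣fiber∣≤1 _))

    incident⇒∈incidentVertices : ∀ {e i} → Incident G (vertex i) e → i ∈ incidentVertices e
    incident⇒∈incidentVertices (inj₁ eq) = x∈p∪q⁺ (inj₁ (∈-subsetOf⁺ (vertex≟ _) eq))
    incident⇒∈incidentVertices (inj₂ eq) = x∈p∪q⁺ (inj₂ (∈-subsetOf⁺ (vertex≟ _) eq))

    exitEdge-incident⇒root : ∀ {i} → Incident G (vertex i) exitEdge → i ≡ root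
    exitEdge-incident⇒root {i} inc with incident⇒endpoint exitEdge-joins inc
    ... | inj₁ eq = vertex-injective eq
    ... | inj₂ eq = ⊥-elim (exit-outside i eq)

    -- At most one vertex of the clique is uncovered; an internal edge covers at most two of its vertices and the
    -- exit edge only root.
    dominating⇒size≤ : Boundary → ∀ {F} → IsEdgeDominating G F →
                       size ≤ suc (2 * ∣ F ∩ internalEdges ∣ + ∣ F ∩ ⁅ exitEdge ⁆ ∣)
    dominating⇒size≤ boundary {F} dom = begin
      size                                  ≡⟨ ∣p∣+∣∁p∣≡n covered ⟨
      ∣ covered ∣ + ∣ ∁ covered ∣           ≤⟨ +-monoʳ-≤ ∣ covered ∣ ∣uncovered∣≤1 ⟩
      ∣ covered ∣ + 1                       ≡⟨ +-comm ∣ covered ∣ 1 ⟩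
      suc ∣ covered ∣                       ≤⟨ s≤s (p⊆q⇒∣p∣≤∣q∣ covered⊆) ⟩
      suc ∣ byInternal ∪ byExit ∣           ≤⟨ s≤s (∣p∪q∣≤∣p∣+∣q∣ byInternal byExit) ⟩
      suc (∣ byInternal ∣ + ∣ byExit ∣)     ≤⟨ s≤s (+-mono-≤ ∣byInternal∣≤ ∣byExit∣≤) ⟩
      suc (2 * ∣ F ∩ internalEdges ∣ + ∣ F ∩ ⁅ exitEdge ⁆ ∣) ∎
      where
      open ≤-Reasoning
      covered byInternal byExit : Subset size
      covered    = subsetOf (covers? F ∘ vertex)
      byInternal = ⋃[ incidentVertices ∈ F ∩ internalEdges ]
      byExit     = ⋃[ const ⁅ root ⁆ ∈ F ∩ ⁅ exitEdge ⁆ ]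
      ∣uncovered∣≤1 : ∣ ∁ covered ∣ ≤ 1
      ∣uncovered∣≤1 = Subsingleton⇒∣p∣≤1 (∁ covered) λ i∉ j∉ →
        dominating⇒AtMostOneUncovered dom (x∈∁p⇒x∉p i∉ ∘ ∈-subsetOf⁺ (covers? F ∘ vertex))
                                          (x∈∁p⇒x∉p j∉ ∘ ∈-subsetOf⁺ (covers? F ∘ vertex))
      covered⊆ : covered ⊆ byInternal ∪ byExit
      covered⊆ {i} i∈ with ∈-subsetOf⁻ (covers? F ∘ vertex) i∈
      ... | e , e∈F , inc with boundary e i inc
      ... | inj₁ int  = x∈p∪q⁺ (inj₁ (x∈⋃ incidentVertices (F ∩ internalEdges)
                          (x∈p∩q⁺ (e∈F , ∈-subsetOf⁺ internal? int)) (incident⇒∈incidentVertices inc)))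
      ... | inj₂ refl = x∈p∪q⁺ (inj₂ (x∈⋃ (const ⁅ root ⁆) (F ∩ ⁅ exitEdge ⁆)
                          (x∈p∩q⁺ (e∈F , x∈⁅x⁆ exitEdge))
                          (subst (_∈ ⁅ root ⁆) (sym (exitEdge-incident⇒root inc)) (x∈⁅x⁆ root))))
      ∣byInternal∣≤ : ∣ byInternal ∣ ≤ 2 * ∣ F ∩ internalEdges ∣
      ∣byInternal∣≤ = ∣⋃∣≤ incidentVertices (F ∩ internalEdges) 2 ∣incidentVertices∣≤2
      ∣byExit∣≤ : ∣ byExit ∣ ≤ ∣ F ∩ ⁅ exitEdge ⁆ ∣
      ∣byExit∣≤ = ≤-trans (∣⋃∣≤ (const ⁅ root ⁆) (F ∩ ⁅ exitEdge ⁆) 1 λ _ → ≤-reflexive (∣⁅x⁆∣≡1 root))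
                          (≤-reflexive (*-identityˡ _))

    -- Every vertex x ≠ u has an edge of F to u, or else (x being reachable from u) to w; that edge determines x.
    separated⇒size≤ : ∀ {F u w} → ¬ Reach G F (vertex u) (vertex w) → size ≤ suc ∣ F ∩ internalEdges ∣
    separated⇒size≤ {F} {u} {w} ¬reach = begin
      size                       ≤⟨ m≤n+m∸n size 1 ⟩
      suc (size ∸ 1)             ≡⟨ cong suc (trans (∣∁p∣≡n∸∣p∣ ⁅ u ⁆) (cong (size ∸_) (∣⁅x⁆∣≡1 u))) ⟨
      suc ∣ ∁ ⁅ u ⁆ ∣            ≤⟨ s≤s (injectiveRelation⇒∣p∣≤∣q∣ (∁ ⁅ u ⁆) (F ∩ internalEdges)
                                                                     LinksToUOrW total injective) ⟩
      suc ∣ F ∩ internalEdges ∣  ∎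
      where
      open ≤-Reasoning
      LinksToUOrW : Fin size → Edge G → Set
      LinksToUOrW x e = ∃[ t ] ((t ≡ u ⊎ t ≡ w) × Joins e (vertex x) (vertex t))
      ≢u : ∀ {x} → x ∈ ∁ ⁅ u ⁆ → x ≢ u
      ≢u = x∉⁅y⁆⇒x≢y ∘ x∈∁p⇒x∉p
      total : ∀ {x} → x ∈ ∁ ⁅ u ⁆ → ∃[ e ] (e ∈ F ∩ internalEdges × LinksToUOrW x e)
      total {x} x∈ with clique (≢u x∈)
      ... | e , joins with e ∈? F
      ... | yes e∈F = e , x∈p∩q⁺ (e∈F , joins⇒internal joins) , u , inj₁ refl , joins
      ... | no e∉F with x ≟ᶠ w
      ... | yes refl = ⊥-elim (¬reach (joins⇒reach e∉F (joins-sym joins)))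
      ... | no x≢w with clique x≢w
      ... | e′ , joins′ with e′ ∈? F
      ... | yes e′∈F = e′ , x∈p∩q⁺ (e′∈F , joins⇒internal joins′) , w , inj₂ refl , joins′
      ... | no e′∉F  =
        ⊥-elim (¬reach (reach-trans (joins⇒reach e∉F (joins-sym joins)) (joins⇒reach e′∉F joins′)))
      ≡w : ∀ {y t} → y ∈ ∁ ⁅ u ⁆ → vertex y ≡ vertex t → t ≡ u ⊎ t ≡ w → y ≡ w
      ≡w y∈ y≡t (inj₁ refl) = ⊥-elim (≢u y∈ (vertex-injective y≡t))
      ≡w y∈ y≡t (inj₂ refl) = vertex-injective y≡t
      injective : ∀ {x x′ e} → x ∈ ∁ ⁅ u ⁆ → x′ ∈ ∁ ⁅ u ⁆ →
                  LinksToUOrW x e → LinksToUOrW x′ e → x ≡ x′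
      injective x∈ x′∈ (t , t∈ , j) (t′ , t′∈ , j′) with incident⇒endpoint j (joins⇒incidentˡ j′)
      ... | inj₁ x′≡x = sym (vertex-injective x′≡x)
      ... | inj₂ x′≡t with incident⇒endpoint j′ (joins⇒incidentˡ j)
      ... | inj₁ x≡x′ = vertex-injective x≡x′
      ... | inj₂ x≡t′ = trans (≡w x∈ x≡t′ t′∈) (sym (≡w x′∈ x′≡t t∈))

    reach-staysInClique : Boundary → ∀ {F v v′} → exitEdge ∈ F → Reach G F v v′ → InClique v → InClique v′
    reach-staysInClique boundary exit∈F (here _) inV = inV
    reach-staysInClique boundary exit∈F (step _ e e∉F joins r) (i , refl) with boundary e i (joins⇒incidentˡ joins)
    ... | inj₂ refl = ⊥-elim (e∉F exit∈F)
    ... | inj₁ int  = reach-staysInClique boundary exit∈F r (incident-internal⇒InClique int (joins⇒incidentʳ joins))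

    exitEdge∈F⇒rootCutOff : Boundary → ∀ {F} → exitEdge ∈ F → ¬ Reach G F (vertex root) exit
    exitEdge∈F⇒rootCutOff boundary exit∈F r with reach-staysInClique boundary exit∈F r (root , refl)
    ... | i , vi≡exit = exit-outside i vi≡exit

    AtMostOneUntouched : List (Edge G) → (Fin size → Set) → Set
    AtMostOneUntouched es P = ∀ {i j} → P i → P j → ¬ Touches es (vertex i) → ¬ Touches es (vertex j) → i ≡ j

    pairUp : (vs : List (Fin size)) → AllPairs _≢_ vs → List (Edge G)
    pairUp (x ∷ y ∷ vs) ((x≢y ∷ _) ∷ _ ∷ distinct) = proj₁ (clique x≢y) ∷ pairUp vs distinct
    pairUp []           _                          = []
    pairUp (_ ∷ [])     _                          = []

    2*∣pairUp∣≤ : ∀ vs distinct → 2 * length (pairUp vs distinct) ≤ length vs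
    2*∣pairUp∣≤ (x ∷ y ∷ vs) ((_ ∷ _) ∷ _ ∷ distinct) = begin
      2 * suc (length (pairUp vs distinct))    ≡⟨ *-suc 2 _ ⟩
      2 + 2 * length (pairUp vs distinct)      ≤⟨ +-monoʳ-≤ 2 (2*∣pairUp∣≤ vs distinct) ⟩
      2 + length vs                            ∎
      where open ≤-Reasoning
    2*∣pairUp∣≤ []           _ = z≤n
    2*∣pairUp∣≤ (_ ∷ [])     _ = z≤n

    pairUp-atMostOneUntouched : ∀ vs distinct {x y} → x ∈ₗ vs → y ∈ₗ vs →
      ¬ Touches (pairUp vs distinct) (vertex x) → ¬ Touches (pairUp vs distinct) (vertex y) → x ≡ y
    pairUp-atMostOneUntouched (_ ∷ [])     _ (here refl) (here refl) _ _ = refl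
    pairUp-atMostOneUntouched (x ∷ y ∷ vs) d@((x≢y ∷ _) ∷ _ ∷ distinct) = untouched-equal
      where
      touchesX : Touches (pairUp (x ∷ y ∷ vs) d) (vertex x)
      touchesX = here (joins⇒incidentˡ (proj₂ (clique x≢y)))
      touchesY : Touches (pairUp (x ∷ y ∷ vs) d) (vertex y)
      touchesY = here (joins⇒incidentʳ (proj₂ (clique x≢y)))
      untouched-equal : ∀ {v v′} → v ∈ₗ x ∷ y ∷ vs → v′ ∈ₗ x ∷ y ∷ vs →
                        ¬ Touches (pairUp (x ∷ y ∷ vs) d) (vertex v) →
                        ¬ Touches (pairUp (x ∷ y ∷ vs) d) (vertex v′) → v ≡ v′
      untouched-equal (here refl)         _                     ¬t  _   = ⊥-elim (¬t touchesX)
      untouched-equal (there (here refl)) _                     ¬t  _   = ⊥-elim (¬t touchesY)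
      untouched-equal (there (there _))   (here refl)           _   ¬t′ = ⊥-elim (¬t′ touchesX)
      untouched-equal (there (there _))   (there (here refl))   _   ¬t′ = ⊥-elim (¬t′ touchesY)
      untouched-equal (there (there v∈))  (there (there v′∈))   ¬t  ¬t′ =
        pairUp-atMostOneUntouched vs distinct v∈ v′∈ (¬t ∘ there) (¬t′ ∘ there)

    pairUp-touchesHead : ∀ {x y vs} (distinct : AllPairs _≢_ (x ∷ vs)) → y ∈ₗ vs →
                         Touches (pairUp (x ∷ vs) distinct) (vertex x)
    pairUp-touchesHead {vs = _ ∷ _} ((x≢y ∷ _) ∷ _ ∷ _) _ = here (joins⇒incidentˡ (proj₂ (clique x≢y)))

    nonRoots : List (Fin size)
    nonRoots = filter (λ i → ¬? (i ≟ᶠ root)) (allFin size)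

    nonRoots-distinct : AllPairs _≢_ nonRoots
    nonRoots-distinct = Uniqueₚ.filter⁺ (λ i → ¬? (i ≟ᶠ root)) (Uniqueₚ.allFin⁺ size)

    ∈-nonRoots : ∀ {i} → i ≢ root → i ∈ₗ nonRoots
    ∈-nonRoots i≢root = ∈-filter⁺ (λ i → ¬? (i ≟ᶠ root)) (∈-allFin _) i≢root

    ∣nonRoots∣<size : length nonRoots < size
    ∣nonRoots∣<size = subst (length nonRoots <_) (length-tabulate id)
      (filter-notAll (λ i → ¬? (i ≟ᶠ root)) (allFin size)
                     (Any.map (λ { refl ¬≢ → ¬≢ refl }) (∈-allFin root)))

    rootAvoidingMatching : ∃[ es ] (2 * length es < size × AtMostOneUntouched es (_≢ root))
    rootAvoidingMatching = pairUp nonRoots nonRoots-distinct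
      , ≤-<-trans (2*∣pairUp∣≤ nonRoots nonRoots-distinct) ∣nonRoots∣<size
      , λ i≢root j≢root →
          pairUp-atMostOneUntouched nonRoots nonRoots-distinct (∈-nonRoots i≢root) (∈-nonRoots j≢root)

    rootCoveringMatching : 2 ≤ size →
      ∃[ es ] (2 * length es ≤ size × AtMostOneUntouched es (const ⊤) × Touches es (vertex root))
    rootCoveringMatching 2≤size = pairUp vs distinct
      , ≤-trans (2*∣pairUp∣≤ vs distinct) ∣nonRoots∣<size
      , (λ _ _ → pairUp-atMostOneUntouched vs distinct (everyVertex _) (everyVertex _))
      , pairUp-touchesHead distinct (∈-nonRoots (proj₂ (anotherVertex root 2≤size)))
      where
      vs : List (Fin size)
      vs = root ∷ nonRoots
      distinct : AllPairs _≢_ vs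
      distinct = All.tabulate (λ i∈ root≡i → proj₂ (∈-filter⁻ (λ i → ¬? (i ≟ᶠ root)) {xs = allFin size} i∈) (sym root≡i))
               ∷ nonRoots-distinct
      everyVertex : ∀ i → i ∈ₗ vs
      everyVertex i with i ≟ᶠ root
      ... | yes refl    = here refl
      ... | no i≢root = there (∈-nonRoots i≢root)
      anotherVertex : ∀ {n} (r : Fin n) → 2 ≤ n → ∃[ i ] i ≢ r
      anotherVertex {suc (suc _)} r _         = punchIn r zero , punchInᵢ≢i r zero
      anotherVertex {suc zero}    r (s≤s ())

    atMostOneUntouched⇒atMostOneUncovered : ∀ {es F} → AtMostOneUntouched es (const ⊤) →
      (∀ {v} → Touches es v → Covers F v) → AtMostOneUncovered F
    atMostOneUntouched⇒atMostOneUncovered untouched touch⇒cover ¬ci ¬cj =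
      untouched _ _ (¬ci ∘ touch⇒cover) (¬cj ∘ touch⇒cover)

    atMostOneUntouchedNonRoot⇒atMostOneUncovered : ∀ {es F} → AtMostOneUntouched es (_≢ root) →
      Covers F (vertex root) → (∀ {v} → Touches es v → Covers F v) → AtMostOneUncovered F
    atMostOneUntouchedNonRoot⇒atMostOneUncovered untouched rootCovered touch⇒cover ¬ci ¬cj =
      untouched (λ { refl → ¬ci rootCovered }) (λ { refl → ¬cj rootCovered })
                (¬ci ∘ touch⇒cover) (¬cj ∘ touch⇒cover)

    oddSize-dominating⇒half≤internal : Boundary → ∀ {p F} → size ≡ suc (2 * p) → IsEdgeDominating G F →
                                  p ≤ ∣ F ∩ internalEdges ∣
    oddSize-dominating⇒half≤internal boundary {p} {F} size≡ dom = 2*m≤1+2*n⇒m≤n p _ (begin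
      2 * p                                            ≤⟨ s≤s⁻¹ (≤-trans (≤-reflexive (sym size≡))
                                                                          (dominating⇒size≤ boundary dom)) ⟩
      2 * ∣ F ∩ internalEdges ∣ + ∣ F ∩ ⁅ exitEdge ⁆ ∣ ≤⟨ +-monoʳ-≤ _ (≤-trans (∣p∩q∣≤∣q∣ F _)
                                                                            (≤-reflexive (∣⁅x⁆∣≡1 exitEdge))) ⟩
      2 * ∣ F ∩ internalEdges ∣ + 1                    ≡⟨ +-comm _ 1 ⟩
      suc (2 * ∣ F ∩ internalEdges ∣)                  ∎)
      where open ≤-Reasoning

  -- Two attached cliques

  -- exits-meet covers the path of length 1 (each exit is the other root) and of length 2 (a common middle vertex).
  record Joined : Set where
    field
      S T : AttachedClique
    private
      module S = AttachedCliqueProperties S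
      module T = AttachedCliqueProperties T
    field
      disjoint     : ∀ i j → S.vertex i ≢ T.vertex j
      exits-meet   : (S.exit ≡ T.vertex T.root × T.exit ≡ S.vertex S.root) ⊎ S.exit ≡ T.exit
      edge-kinds   : ∀ e → S.CliqueEdge e ⊎ T.CliqueEdge e ⊎ e ≡ S.exitEdge ⊎ e ≡ T.exitEdge
      vertex-kinds : ∀ v → S.InClique v ⊎ T.InClique v ⊎ v ≡ S.exit

  swap : Joined → Joined
  swap J = record
    { S            = T
    ; T            = S
    ; disjoint     = λ i j → disjoint j i ∘ sym
    ; exits-meet   = Sum.map Product.swap sym exits-meet
    ; edge-kinds   = λ e → reorder (edge-kinds e)
    ; vertex-kinds = vertex-kinds′
    }
    where
    open Joined J
    module S = AttachedCliqueProperties S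
    module T = AttachedCliqueProperties T
    reorder : ∀ {A B C D : Set} → A ⊎ B ⊎ C ⊎ D → B ⊎ A ⊎ D ⊎ C
    reorder (inj₁ a)               = inj₂ (inj₁ a)
    reorder (inj₂ (inj₁ b))        = inj₁ b
    reorder (inj₂ (inj₂ (inj₁ c))) = inj₂ (inj₂ (inj₂ c))
    reorder (inj₂ (inj₂ (inj₂ d))) = inj₂ (inj₂ (inj₁ d))
    vertex-kinds′ : ∀ v → T.InClique v ⊎ S.InClique v ⊎ v ≡ T.exit
    vertex-kinds′ v with vertex-kinds v | exits-meet
    ... | inj₁ inS         | _                   = inj₂ (inj₁ inS)
    ... | inj₂ (inj₁ inT)  | _                   = inj₁ inT
    ... | inj₂ (inj₂ refl) | inj₁ (exit≡root , _) = inj₁ (T.root , sym exit≡root)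
    ... | inj₂ (inj₂ refl) | inj₂ exit≡exit      = inj₂ (inj₂ exit≡exit)

  module FirstClique (J : Joined) where
    open Joined J
    private
      module S = AttachedCliqueProperties S
      module T = AttachedCliqueProperties T

    boundary : S.Boundary
    boundary e i inc with edge-kinds e
    ... | inj₁ (i′ , j′ , _ , eq)        = inj₁ ((i′ , sym (cong proj₁ eq)) , (j′ , sym (cong proj₂ eq)))
    ... | inj₂ (inj₁ (i′ , j′ , _ , eq)) with inc
    ...   | inj₁ vi≡ = ⊥-elim (disjoint i i′ (trans vi≡ (cong proj₁ eq)))
    ...   | inj₂ vi≡ = ⊥-elim (disjoint i j′ (trans vi≡ (cong proj₂ eq)))
    boundary e i inc | inj₂ (inj₂ (inj₁ e≡)) = inj₂ e≡
    boundary e i inc | inj₂ (inj₂ (inj₂ refl)) with incident⇒endpoint T.exitEdge-joins inc | exits-meet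
    ... | inj₁ vi≡rootT | _                = ⊥-elim (disjoint i T.root vi≡rootT)
    ... | inj₂ vi≡exitT | inj₂ exitS≡exitT = ⊥-elim (S.exit-outside i (trans vi≡exitT (sym exitS≡exitT)))
    ... | inj₂ _        | inj₁ (exitS≡rootT , exitT≡rootS) =
      inj₂ (S.exitEdge-unique (subst₂ (Joins T.exitEdge) exitT≡rootS (sym exitS≡rootT) (joins-sym T.exitEdge-joins)))

    internal⇒≢exits : ∀ {e} → e ∈ S.internalEdges → e ≢ S.exitEdge × e ≢ T.exitEdge
    internal⇒≢exits e∈ = (λ { refl → exit∉ (joins⇒incidentʳ S.exitEdge-joins) })
                       , (λ { refl → rootT∉ (joins⇒incidentˡ T.exitEdge-joins) })
      where
      int = ∈-subsetOf⁻ S.internal? e∈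
      exit∉ : ¬ Incident G S.exit _
      exit∉ inc with S.incident-internal⇒InClique int inc
      ... | i , vi≡exit = S.exit-outside i vi≡exit
      rootT∉ : ¬ Incident G (T.vertex T.root) _
      rootT∉ inc with S.incident-internal⇒InClique int inc
      ... | i , vi≡rootT = disjoint i T.root vi≡rootT

  module JoinedProperties (J : Joined) where
    open Joined J public
    module S = AttachedCliqueProperties S
    module T = AttachedCliqueProperties T
    open FirstClique J public renaming (boundary to S-boundary; internal⇒≢exits to S-internal⇒≢exits)
    open FirstClique (swap J) public renaming (boundary to T-boundary; internal⇒≢exits to T-internal⇒≢exits)

    exitEdges : EdgeSet G
    exitEdges = ⁅ S.exitEdge ⁆ ∪ ⁅ T.exitEdge ⁆

    insideS insideT onExits : EdgeSet G → ℕ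
    insideS F = ∣ F ∩ S.internalEdges ∣
    insideT F = ∣ F ∩ T.internalEdges ∣
    onExits F = ∣ F ∩ exitEdges ∣

    parts≤∣F∣ : ∀ F → insideS F + insideT F + onExits F ≤ ∣ F ∣
    parts≤∣F∣ F = begin
      insideS F + insideT F + onExits F
        ≤⟨ +-monoˡ-≤ (onExits F) (Disjoint⇒∣r∩p∣+∣r∩q∣≤∣r∩[p∪q]∣ F _ _ S#T) ⟩
      ∣ F ∩ (S.internalEdges ∪ T.internalEdges) ∣ + onExits F
        ≤⟨ Disjoint⇒∣r∩p∣+∣r∩q∣≤∣r∩[p∪q]∣ F _ _ internal#exits ⟩
      ∣ F ∩ ((S.internalEdges ∪ T.internalEdges) ∪ exitEdges) ∣
        ≤⟨ ∣p∩q∣≤∣p∣ F _ ⟩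
      ∣ F ∣ ∎
      where
      open ≤-Reasoning
      S#T : Disjoint S.internalEdges T.internalEdges
      S#T e∈S e∈T with ∈-subsetOf⁻ S.internal? e∈S | ∈-subsetOf⁻ T.internal? e∈T
      ... | (i , vi≡) , _ | (j , vj≡) , _ = disjoint i j (trans vi≡ (sym vj≡))
      ≢exits : ∀ {e} → e ≢ S.exitEdge × e ≢ T.exitEdge → e ∉ exitEdges
      ≢exits (≢eS , ≢eT) e∈ with x∈p∪q⁻ ⁅ S.exitEdge ⁆ ⁅ T.exitEdge ⁆ e∈
      ... | inj₁ e∈eS = ≢eS (x∈⁅y⁆⇒x≡y _ e∈eS)
      ... | inj₂ e∈eT = ≢eT (x∈⁅y⁆⇒x≡y _ e∈eT)
      internal#exits : Disjoint (S.internalEdges ∪ T.internalEdges) exitEdges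
      internal#exits e∈ with x∈p∪q⁻ S.internalEdges T.internalEdges e∈
      ... | inj₁ e∈S = ≢exits (S-internal⇒≢exits e∈S)
      ... | inj₂ e∈T = ≢exits (Product.swap (T-internal⇒≢exits e∈T))

    onExitS≤onExits : ∀ F → ∣ F ∩ ⁅ S.exitEdge ⁆ ∣ ≤ onExits F
    onExitS≤onExits F = p⊆q⇒∣p∣≤∣q∣ (∩-monoʳ-⊆ F (p⊆p∪q ⁅ T.exitEdge ⁆))

    onExitT≤onExits : ∀ F → ∣ F ∩ ⁅ T.exitEdge ⁆ ∣ ≤ onExits F
    onExitT≤onExits F = p⊆q⇒∣p∣≤∣q∣ (∩-monoʳ-⊆ F (q⊆p∪q ⁅ S.exitEdge ⁆ ⁅ T.exitEdge ⁆))

    onExitS+onExitT≤onExits : S.exitEdge ≢ T.exitEdge →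
                              ∀ F → ∣ F ∩ ⁅ S.exitEdge ⁆ ∣ + ∣ F ∩ ⁅ T.exitEdge ⁆ ∣ ≤ onExits F
    onExitS+onExitT≤onExits eS≢eT F = Disjoint⇒∣r∩p∣+∣r∩q∣≤∣r∩[p∪q]∣ F _ _ λ e∈eS e∈eT →
      eS≢eT (trans (sym (x∈⁅y⁆⇒x≡y _ e∈eS)) (x∈⁅y⁆⇒x≡y _ e∈eT))

    exitEdge∈F⇒0<onExits : ∀ {F e} → e ∈ F → e ∈ exitEdges → 0 < onExits F
    exitEdge∈F⇒0<onExits e∈F e∈exits = x∈p⇒0<∣p∣ (x∈p∩q⁺ (e∈F , e∈exits))

    dominating-if : ∀ {F} → S.AtMostOneUncovered F → T.AtMostOneUncovered F →
                    Covers F (S.vertex S.root) → Covers F (T.vertex T.root) → IsEdgeDominating G F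
    dominating-if {F} S-unc T-unc S-root T-root = endpointCovered⇒dominating F endpointCovered
      where
      cliqueEdgeCovered : ∀ {k} {vertex : Fin k → Vertex G} →
        (∀ {i j} → ¬ Covers F (vertex i) → ¬ Covers F (vertex j) → i ≡ j) →
        ∀ {e i j} → i ≢ j → endpoints G e ≡ (vertex i , vertex j) →
        Covers F (proj₁ (endpoints G e)) ⊎ Covers F (proj₂ (endpoints G e))
      cliqueEdgeCovered {vertex = vertex} unc {i = i} {j} i≢j eq with covers? F (vertex i) | covers? F (vertex j)
      ... | yes ci | _      = joins⇒coversEndpoint (inj₁ eq) ci
      ... | no _   | yes cj = joins⇒coversEndpoint (inj₂ eq) cj
      ... | no ¬ci | no ¬cj = ⊥-elim (i≢j (unc ¬ci ¬cj))
      endpointCovered : ∀ e → e ∉ F → Covers F (proj₁ (endpoints G e)) ⊎ Covers F (proj₂ (endpoints G e))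
      endpointCovered e _ with edge-kinds e
      ... | inj₁ (i , j , i≢j , eq)        = cliqueEdgeCovered S-unc i≢j eq
      ... | inj₂ (inj₁ (i , j , i≢j , eq)) = cliqueEdgeCovered T-unc i≢j eq
      ... | inj₂ (inj₂ (inj₁ refl))        = joins⇒coversEndpoint S.exitEdge-joins S-root
      ... | inj₂ (inj₂ (inj₂ refl))        = joins⇒coversEndpoint T.exitEdge-joins T-root

    -- Otherwise no clique has two vertices separated by F, and every vertex is reachable from S's root.
    exitsKept⇒cliqueSeparated : ∀ {F} → S.exitEdge ∉ F → T.exitEdge ∉ F → RemovalDisconnects G F →
                                S.size ≤ suc (insideS F) ⊎ T.size ≤ suc (insideT F)
    exitsKept⇒cliqueSeparated {F} eS∉F eT∉F (u , v , ¬u→v)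
      with S.size ≤? suc (insideS F) | T.size ≤? suc (insideT F)
    ... | yes S-small | _           = inj₁ S-small
    ... | no _        | yes T-small = inj₂ T-small
    ... | no S-large  | no T-large  =
      ⊥-elim (fromRootS u λ r→u → fromRootS v λ r→v → ¬u→v (reach-trans (reach-sym r→u) r→v))
      where
      rootS→exitS : Reach G F (S.vertex S.root) S.exit
      rootS→exitS = joins⇒reach eS∉F S.exitEdge-joins
      rootS→rootT : Reach G F (S.vertex S.root) (T.vertex T.root)
      rootS→rootT with exits-meet
      ... | inj₁ (exitS≡rootT , _) = subst (Reach G F _) exitS≡rootT rootS→exitS
      ... | inj₂ exitS≡exitT       = reach-trans rootS→exitS
        (subst (λ x → Reach G F x _) (sym exitS≡exitT) (reach-sym (joins⇒reach eT∉F T.exitEdge-joins)))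
      fromRootS : ∀ x → ¬ ¬ Reach G F (S.vertex S.root) x
      fromRootS x with vertex-kinds x
      ... | inj₁ (i , refl)        = λ ¬r → S-large (S.separated⇒size≤ ¬r)
      ... | inj₂ (inj₁ (j , refl)) = λ ¬r → T-large (T.separated⇒size≤ (¬r ∘ reach-trans rootS→rootT))
      ... | inj₂ (inj₂ refl)       = λ ¬r → ¬r rootS→exitS

    exitEdgeWithMatchings-cutDominating : ∀ esS esT → S.AtMostOneUntouched esS (_≢ S.root) →
      let F = fromList (S.exitEdge ∷ esS ++ esT) in
      T.AtMostOneUncovered F → Covers F (T.vertex T.root) →
      IsEdgeCutDominating G F × ∣ F ∣ ≤ suc (length esS + length esT)
    exitEdgeWithMatchings-cutDominating esS esT untouchedS T-unc T-root = (dominating , disconnected) , size≤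
      where
      L = S.exitEdge ∷ esS ++ esT
      F = fromList L
      S-root : Covers F (S.vertex S.root)
      S-root = touches⇒covers L (here (joins⇒incidentˡ S.exitEdge-joins))
      dominating : IsEdgeDominating G F
      dominating = dominating-if
        (S.atMostOneUntouchedNonRoot⇒atMostOneUncovered untouchedS S-root (touches⇒covers L ∘ there ∘ Anyₚ.++⁺ˡ))
        T-unc S-root T-root
      disconnected : RemovalDisconnects G F
      disconnected =
        S.vertex S.root , S.exit , S.exitEdge∈F⇒rootCutOff S-boundary (x∈p∪q⁺ (inj₁ (x∈⁅x⁆ S.exitEdge)))
      size≤ : ∣ F ∣ ≤ suc (length esS + length esT)
      size≤ = ≤-trans (∣fromList∣≤length L) (≤-reflexive (cong suc (length-++ esS)))

    sharedExit⇒minimumDominatingCut : S.exitEdge ≡ T.exitEdge → ∀ {P} → S.size ≡ 2 * P →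
                                      ∃ IsMinimumDominatingCut
    sharedExit⇒minimumDominatingCut eS≡eT {P} S-even with S.rootAvoidingMatching | T.rootAvoidingMatching
    ... | esS , 2lS<S , untouchedS | esT , 2lT<T , untouchedT =
      F₀ , cut , λ F dom → ≤-trans size≤ (≤-trans (lower F dom) (parts≤∣F∣ F))
      where
      L  = S.exitEdge ∷ esS ++ esT
      F₀ = fromList L
      T-root : Covers F₀ (T.vertex T.root)
      T-root = touches⇒covers L (here (joins⇒incidentˡ (subst (λ e → Joins e _ _) (sym eS≡eT) T.exitEdge-joins)))
      T-unc : T.AtMostOneUncovered F₀
      T-unc = T.atMostOneUntouchedNonRoot⇒atMostOneUncovered untouchedT T-root
                (touches⇒covers L ∘ there ∘ Anyₚ.++⁺ʳ esS)
      cut&size = exitEdgeWithMatchings-cutDominating esS esT untouchedS T-unc T-root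
      cut   = proj₁ cut&size
      size≤ = proj₂ cut&size
      lower : ∀ F → IsEdgeDominating G F → suc (length esS + length esT) ≤ insideS F + insideT F + onExits F
      lower F dom = sharedExitBound (length esS) (length esT) P T.size (insideS F) (insideT F) (onExits F)
        (*-cancelˡ-< 2 _ _ (subst (2 * length esS <_) S-even 2lS<S)) 2lT<T
        (≤-trans (≤-reflexive (sym S-even))
                 (≤-trans (S.dominating⇒size≤ S-boundary dom) (s≤s (+-monoʳ-≤ _ (onExitS≤onExits F)))))
        (≤-trans (T.dominating⇒size≤ T-boundary dom) (s≤s (+-monoʳ-≤ _ (onExitT≤onExits F))))

    separateExits⇒minimumDominatingCut : S.exitEdge ≢ T.exitEdge → 2 ≤ T.size → ∀ {P} → S.size ≡ 2 * P →
                                          ∃ IsMinimumDominatingCut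
    separateExits⇒minimumDominatingCut eS≢eT 2≤T {P} S-even with S.rootAvoidingMatching | T.rootCoveringMatching 2≤T
    ... | esS , 2lS<S , untouchedS | esT , 2lT≤T , untouchedT , touchesRootT =
      F₀ , cut , λ F dom → ≤-trans size≤ (≤-trans (lower F dom) (parts≤∣F∣ F))
      where
      L  = S.exitEdge ∷ esS ++ esT
      F₀ = fromList L
      esT⊆ : ∀ {v} → Touches esT v → Covers F₀ v
      esT⊆ = touches⇒covers L ∘ there ∘ Anyₚ.++⁺ʳ esS
      cut&size = exitEdgeWithMatchings-cutDominating esS esT untouchedS
                   (T.atMostOneUntouched⇒atMostOneUncovered untouchedT esT⊆) (esT⊆ touchesRootT)
      cut   = proj₁ cut&size
      size≤ = proj₂ cut&size
      lower : ∀ F → IsEdgeDominating G F → suc (length esS + length esT) ≤ insideS F + insideT F + onExits F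
      lower F dom = ≤-trans
        (separateExitsBound (length esS) (length esT) P T.size (insideS F) (insideT F)
                            ∣ F ∩ ⁅ S.exitEdge ⁆ ∣ ∣ F ∩ ⁅ T.exitEdge ⁆ ∣
          (*-cancelˡ-< 2 _ _ (subst (2 * length esS <_) S-even 2lS<S)) 2lT≤T
          (≤-trans (≤-reflexive (sym S-even)) (S.dominating⇒size≤ S-boundary dom))
          (T.dominating⇒size≤ T-boundary dom))
        (+-monoʳ-≤ _ (onExitS+onExitT≤onExits eS≢eT F))

    -- The exit edges coincide exactly for the path of length 1.
    even⇒minimumDominatingCut : ∀ {P} → S.size ≡ 2 * P → 2 ≤ T.size → ∃ IsMinimumDominatingCut
    even⇒minimumDominatingCut {P} S-even 2≤T with S.exitEdge ≟ᶠ T.exitEdge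
    ... | yes eS≡eT = sharedExit⇒minimumDominatingCut eS≡eT {P} S-even
    ... | no eS≢eT  = separateExits⇒minimumDominatingCut eS≢eT 2≤T {P} S-even

    bothOdd⇒∃dominating-size≤p+q : ∀ {p q} → S.size ≡ suc (2 * p) → T.size ≡ suc (2 * q) →
                                   2 < S.size → 2 < T.size → ∃[ F ] (IsEdgeDominating G F × ∣ F ∣ ≤ p + q)
    bothOdd⇒∃dominating-size≤p+q {p} {q} S-odd T-odd 2<S 2<T
      with S.rootCoveringMatching (<⇒≤ 2<S) | T.rootCoveringMatching (<⇒≤ 2<T)
    ... | esS , 2lS≤S , untouchedS , touchesRootS | esT , 2lT≤T , untouchedT , touchesRootT =
      fromList L , dominating , size≤
      where
      L = esS ++ esT
      esS⊆ : ∀ {v} → Touches esS v → Covers (fromList L) v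
      esS⊆ = touches⇒covers L ∘ Anyₚ.++⁺ˡ
      esT⊆ : ∀ {v} → Touches esT v → Covers (fromList L) v
      esT⊆ = touches⇒covers L ∘ Anyₚ.++⁺ʳ esS
      dominating : IsEdgeDominating G (fromList L)
      dominating = dominating-if (S.atMostOneUntouched⇒atMostOneUncovered untouchedS esS⊆)
                                 (T.atMostOneUntouched⇒atMostOneUncovered untouchedT esT⊆)
                                 (esS⊆ touchesRootS) (esT⊆ touchesRootT)
      size≤ : ∣ fromList L ∣ ≤ p + q
      size≤ = ≤-trans (∣fromList∣≤length L) (≤-trans (≤-reflexive (length-++ esS))
        (+-mono-≤ (2*m≤1+2*n⇒m≤n (length esS) p (≤-trans 2lS≤S (≤-reflexive S-odd)))
                  (2*m≤1+2*n⇒m≤n (length esT) q (≤-trans 2lT≤T (≤-reflexive T-odd)))))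

    bothOdd⇒cutDominating-size>p+q : ∀ {p q F} → S.size ≡ suc (2 * p) → T.size ≡ suc (2 * q) →
                                     2 < S.size → 2 < T.size → IsEdgeCutDominating G F → suc (p + q) ≤ ∣ F ∣
    bothOdd⇒cutDominating-size>p+q {p} {q} {F} S-odd T-odd 2<S 2<T (dom , disconnected) = ≤-trans bound (parts≤∣F∣ F)
      where
      1≤p = odd>2⇒1≤half S-odd 2<S
      1≤q = odd>2⇒1≤half T-odd 2<T
      p≤ : p ≤ insideS F
      p≤ = S.oddSize-dominating⇒half≤internal S-boundary S-odd dom
      q≤ : q ≤ insideT F
      q≤ = T.oddSize-dominating⇒half≤internal T-boundary T-odd dom
      viaExit : 0 < onExits F → suc (p + q) ≤ insideS F + insideT F + onExits F
      viaExit 0<onExits =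
        subst (_≤ insideS F + insideT F + onExits F) (+-comm (p + q) 1) (+-mono-≤ (+-mono-≤ p≤ q≤) 0<onExits)
      separatedClique : ∀ {n r x} → n ≡ suc (2 * r) → 1 ≤ r → n ≤ suc x → suc r ≤ x
      separatedClique refl 1≤r n≤1+x = ≤-trans (1≤p⇒1+p≤2*p 1≤r) (s≤s⁻¹ n≤1+x)
      viaSeparation : S.size ≤ suc (insideS F) ⊎ T.size ≤ suc (insideT F) → suc (p + q) ≤ insideS F + insideT F
      viaSeparation (inj₁ S≤) = +-mono-≤ (separatedClique S-odd 1≤p S≤) q≤
      viaSeparation (inj₂ T≤) =
        subst (_≤ insideS F + insideT F) (+-suc p q) (+-mono-≤ p≤ (separatedClique T-odd 1≤q T≤))
      bound : suc (p + q) ≤ insideS F + insideT F + onExits F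
      bound with S.exitEdge ∈? F | T.exitEdge ∈? F
      ... | yes eS∈F | _        = viaExit (exitEdge∈F⇒0<onExits eS∈F (x∈p∪q⁺ (inj₁ (x∈⁅x⁆ _))))
      ... | no _     | yes eT∈F = viaExit (exitEdge∈F⇒0<onExits eT∈F (x∈p∪q⁺ (inj₂ (x∈⁅x⁆ _))))
      ... | no eS∉F  | no eT∉F  =
        ≤-trans (viaSeparation (exitsKept⇒cliqueSeparated eS∉F eT∉F disconnected)) (m≤m+n _ (onExits F))

  module _ (J : Joined) where
    open JoinedProperties J
    private module Swapped = JoinedProperties (swap J)

    cutDomination≡domination⇔even : 2 < S.size → 2 < T.size → ∀ {g c} →
      IsEdgeDominationNumber G g → IsEdgeCutDominationNumber G c → (c ≡ g) ⇔ ((2 ∣ T.size) ⊎ (2 ∣ S.size))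
    cutDomination≡domination⇔even 2<S 2<T {g} {c} ((Fg , domg , ∣Fg∣≡g) , minDom) ((Fc , cutc , ∣Fc∣≡c) , minCut) =
      mk⇔ onlyIf if
      where
      onlyIf : c ≡ g → (2 ∣ T.size) ⊎ (2 ∣ S.size)
      onlyIf c≡g with even⊎odd S.size | even⊎odd T.size
      ... | inj₁ 2∣S        | _               = inj₂ 2∣S
      ... | inj₂ _          | inj₁ 2∣T        = inj₁ 2∣T
      ... | inj₂ (p , S-odd) | inj₂ (q , T-odd) with bothOdd⇒∃dominating-size≤p+q {p} {q} S-odd T-odd 2<S 2<T
      ...   | F₁ , dom₁ , ∣F₁∣≤ = ⊥-elim (<-irrefl (sym c≡g) (begin-strict
        g       ≤⟨ minDom F₁ dom₁ ⟩
        ∣ F₁ ∣  ≤⟨ ∣F₁∣≤ ⟩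
        p + q   <⟨ bothOdd⇒cutDominating-size>p+q {p} {q} S-odd T-odd 2<S 2<T cutc ⟩
        ∣ Fc ∣  ≡⟨ ∣Fc∣≡c ⟩
        c       ∎))
        where open ≤-Reasoning
      optimal : (2 ∣ T.size) ⊎ (2 ∣ S.size) → ∃ IsMinimumDominatingCut
      optimal (inj₁ (divides Q T≡)) = Swapped.even⇒minimumDominatingCut {Q} (trans T≡ (*-comm Q 2)) (<⇒≤ 2<S)
      optimal (inj₂ (divides P S≡)) = even⇒minimumDominatingCut {P} (trans S≡ (*-comm P 2)) (<⇒≤ 2<T)
      if : (2 ∣ T.size) ⊎ (2 ∣ S.size) → c ≡ g
      if even with optimal even
      ... | F₀ , cut₀ , optimal₀ = ≤-antisym
        (≤-trans (minCut F₀ cut₀) (≤-trans (optimal₀ Fg domg) (≤-reflexive ∣Fg∣≡g)))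
        (≤-trans (minDom Fc (proj₁ cutc)) (≤-reflexive ∣Fc∣≡c))

-- The two graphs of the theorem

∈-cliqueEdges : ∀ {k} {i j : Fin k} → toℕ i < toℕ j → (i , j) ∈ₗ cliqueEdges k
∈-cliqueEdges {k} {i} {j} i<j = ∈-concatMap⁺ _ (Any.map (λ { refl → ∈-concatMap⁺ _
                                   (Any.map (λ { refl → selected (<⇒<ᵇ i<j) }) (∈-allFin j)) }) (∈-allFin i))
  where
  selected : ∀ {b} → Bool.T b → (i , j) ∈ₗ (if b then [ (i , j) ] else [])
  selected {true} _ = here refl

cliqueEdges-irreflexive : ∀ k → All (λ p → proj₁ p ≢ proj₂ p) (cliqueEdges k)
cliqueEdges-irreflexive k = concat⁺ (map⁺ (universal (λ i →
  concat⁺ (map⁺ (universal (λ j → onlyIf (toℕ i <ᵇ toℕ j) (i≢j i j)) (allFin k)))) (allFin k)))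
  where
  i≢j : ∀ i j → Bool.T (toℕ i <ᵇ toℕ j) → i ≢ j
  i≢j i j i<ᵇj refl = <-irrefl refl (<ᵇ⇒< (toℕ i) (toℕ i) i<ᵇj)
  onlyIf : ∀ {A : Set} {P : A → Set} b {x} → (Bool.T b → P x) → All P (if b then [ x ] else [])
  onlyIf true  px = px tt ∷ []
  onlyIf false _  = []

↑ˡ≢↑ʳ : ∀ {n m} (i : Fin n) (j : Fin m) → i ↑ˡ m ≢ n ↑ʳ j
↑ˡ≢↑ʳ {n} {m} i j eq with () ← trans (sym (splitAt-↑ˡ n i m)) (trans (cong (splitAt n) eq) (splitAt-↑ʳ n m j))

-- f places K_n + K_m in the graph: the identity for the path of length 1, _↑ˡ 1 for the path of length 2.
module TwoCliquesEmbedding {V : Set} {n m : ℕ} (f : Fin (n + m) → V) where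

  left : Fin n → V
  left i = f (i ↑ˡ m)

  right : Fin m → V
  right j = f (n ↑ʳ j)

  embeddedEdges : List (V × V)
  embeddedEdges = map (λ p → (f (proj₁ p) , f (proj₂ p))) (twoCliqueEdges n m)

  LeftEdge RightEdge : V × V → Set
  LeftEdge  p = ∃[ i ] ∃[ j ] (i ≢ j × p ≡ (left i , left j))
  RightEdge p = ∃[ i ] ∃[ j ] (i ≢ j × p ≡ (right i , right j))

  embeddedEdges-kinds : All (λ p → LeftEdge p ⊎ RightEdge p) embeddedEdges
  embeddedEdges-kinds = map⁺ (++⁺
    (map⁺ (All.map (λ {p} i≢j → inj₁ (proj₁ p , proj₂ p , i≢j , refl)) (cliqueEdges-irreflexive n)))
    (map⁺ (All.map (λ {p} i≢j → inj₂ (proj₁ p , proj₂ p , i≢j , refl)) (cliqueEdges-irreflexive m))))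

  ∈-embeddedEdgesˡ : ∀ {i j} → toℕ i < toℕ j → (left i , left j) ∈ₗ embeddedEdges
  ∈-embeddedEdgesˡ i<j = ∈-map⁺ _ (∈-++⁺ˡ (∈-map⁺ _ (∈-cliqueEdges i<j)))

  ∈-embeddedEdgesʳ : ∀ {i j} → toℕ i < toℕ j → (right i , right j) ∈ₗ embeddedEdges
  ∈-embeddedEdgesʳ i<j = ∈-map⁺ _ (∈-++⁺ʳ _ (∈-map⁺ _ (∈-cliqueEdges i<j)))

  IsLeft IsRight : V → Set
  IsLeft  v = ∃[ i ] left i ≡ v
  IsRight v = ∃[ j ] right j ≡ v

  embeddedEdges-avoid : ∀ {u w} → ¬ (IsLeft u × IsLeft w) → ¬ (IsRight u × IsRight w) →
                        All (λ p → ¬ (p ≡ (u , w) ⊎ p ≡ (w , u))) embeddedEdges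
  embeddedEdges-avoid {u} {w} ¬LL ¬RR = All.map avoid embeddedEdges-kinds
    where
    avoid : ∀ {p} → LeftEdge p ⊎ RightEdge p → ¬ (p ≡ (u , w) ⊎ p ≡ (w , u))
    avoid (inj₁ (i , j , _ , refl)) (inj₁ eq) = ¬LL ((i , cong proj₁ eq) , (j , cong proj₂ eq))
    avoid (inj₁ (i , j , _ , refl)) (inj₂ eq) = ¬LL ((j , cong proj₂ eq) , (i , cong proj₁ eq))
    avoid (inj₂ (i , j , _ , refl)) (inj₁ eq) = ¬RR ((i , cong proj₁ eq) , (j , cong proj₂ eq))
    avoid (inj₂ (i , j , _ , refl)) (inj₂ eq) = ¬RR ((j , cong proj₂ eq) , (i , cong proj₁ eq))

module _ {A : Set} {P : Pred A 0ℓ} (P? : Decidable P) where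

  lookup⇒0<∣filter∣ : ∀ xs i → P (lookup xs i) → 0 < length (filter P? xs)
  lookup⇒0<∣filter∣ xs i p = filter-some P? (Any.map (λ eq → subst P eq p) (∈-lookup {xs = xs} i))

  ∣filter∣≤1⇒lookup-injective : ∀ xs → length (filter P? xs) ≤ 1 →
                                ∀ {i j} → P (lookup xs i) → P (lookup xs j) → i ≡ j
  ∣filter∣≤1⇒lookup-injective (x ∷ xs) bound {zero}  {zero}  _  _  = refl
  ∣filter∣≤1⇒lookup-injective (x ∷ xs) bound {zero}  {suc j} px pj with P? x
  ... | yes _  = ⊥-elim (<-irrefl refl (≤-trans (s≤s (lookup⇒0<∣filter∣ xs j pj)) bound))
  ... | no ¬px = ⊥-elim (¬px px)
  ∣filter∣≤1⇒lookup-injective (x ∷ xs) bound {suc i} {zero}  pi px with P? x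
  ... | yes _  = ⊥-elim (<-irrefl refl (≤-trans (s≤s (lookup⇒0<∣filter∣ xs i pi)) bound))
  ... | no ¬px = ⊥-elim (¬px px)
  ∣filter∣≤1⇒lookup-injective (x ∷ xs) bound {suc i} {suc j} pi pj with P? x
  ... | yes _ = ⊥-elim (<-irrefl refl (≤-trans (s≤s (lookup⇒0<∣filter∣ xs i pi)) bound))
  ... | no _  = cong suc (∣filter∣≤1⇒lookup-injective xs bound pi pj)

  ∣filter∣-skip : ∀ {ys} zs → All (¬_ ∘ P) ys → length (filter P? (ys ++ zs)) ≡ length (filter P? zs)
  ∣filter∣-skip {ys} zs none rewrite filter-++ P? ys zs | filter-none P? none = refl

  ∣filter[x,y]∣≤1 : ∀ x y → ¬ P x ⊎ ¬ P y → length (filter P? (x ∷ y ∷ [])) ≤ 1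
  ∣filter[x,y]∣≤1 x y ¬Px⊎¬Py with P? x
  ... | no _  = length-filter P? (y ∷ [])
  ... | yes px with P? y
  ...   | no _  = s≤s z≤n
  ...   | yes py = ⊥-elim (Sum.[ (λ ¬px → ¬px px) , (λ ¬py → ¬py py) ] ¬Px⊎¬Py)

module _ (G : Graph) where

  edgeAt : ∀ {p} → p ∈ₗ edges G → ∃[ e ] endpoints G e ≡ p
  edgeAt p∈ = Any.index p∈ , sym (Anyₚ.lookup-index p∈)

  orderedPairs⇒clique : ∀ {k} (ι : Fin k → Vertex G) → (∀ {i j} → toℕ i < toℕ j → (ι i , ι j) ∈ₗ edges G) →
                        ∀ {i j} → i ≢ j → ∃[ e ] Joins G e (ι i) (ι j)
  orderedPairs⇒clique ι ∈edges {i} {j} i≢j with <-cmp (toℕ i) (toℕ j)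
  ... | tri< i<j _ _ = proj₁ (edgeAt (∈edges i<j)) , inj₁ (proj₂ (edgeAt (∈edges i<j)))
  ... | tri≈ _ i≡j _ = ⊥-elim (i≢j (toℕ-injective i≡j))
  ... | tri> _ _ j<i = proj₁ (edgeAt (∈edges j<i)) , inj₂ (proj₂ (edgeAt (∈edges j<i)))

  joining? : ∀ u w (p : Vertex G × Vertex G) → Dec (p ≡ (u , w) ⊎ p ≡ (w , u))
  joining? u w p = ≡-dec _≟ᶠ_ _≟ᶠ_ p (u , w) ⊎-dec ≡-dec _≟ᶠ_ _≟ᶠ_ p (w , u)

  -- Edges are positions in the edge list: an edge is determined by its endpoints when they occur only once.
  uniqueJoiningEdge : ∀ {u w} → length (filter (joining? u w) (edges G)) ≤ 1 →
                      ∀ {e e′} → Joins G e u w → Joins G e′ u w → e ≡ e′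
  uniqueJoiningEdge bound = ∣filter∣≤1⇒lookup-injective (joining? _ _) (edges G) bound

module PathOfLength1 (n m : ℕ) (a : Fin n) (b : Fin m) where

  G : Graph
  G = joinPath1 n m a b

  open TwoCliquesEmbedding {n = n} {m} (λ v → v)

  embeddedEdges≡ : embeddedEdges ≡ twoCliqueEdges n m
  embeddedEdges≡ = map-id (twoCliqueEdges n m)

  left≢right : ∀ i j → left i ≢ right j
  left≢right = ↑ˡ≢↑ʳ

  ∈-edgesˡ : ∀ {i j} → toℕ i < toℕ j → (left i , left j) ∈ₗ edges G
  ∈-edgesˡ {i} {j} i<j = ∈-++⁺ˡ (subst ((left i , left j) ∈ₗ_) embeddedEdges≡ (∈-embeddedEdgesˡ i<j))

  ∈-edgesʳ : ∀ {i j} → toℕ i < toℕ j → (right i , right j) ∈ₗ edges G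
  ∈-edgesʳ {i} {j} i<j = ∈-++⁺ˡ (subst ((right i , right j) ∈ₗ_) embeddedEdges≡ (∈-embeddedEdgesʳ i<j))

  bridge : ∃[ e ] endpoints G e ≡ (left a , right b)
  bridge = edgeAt G (∈-++⁺ʳ (twoCliqueEdges n m) (here refl))

  bridge-unique : ∀ {e} → Joins G e (left a) (right b) → e ≡ proj₁ bridge
  bridge-unique joins = uniqueJoiningEdge G bound joins (inj₁ (proj₂ bridge))
    where
    P? = joining? G (left a) (right b)
    bound : length (filter P? (edges G)) ≤ 1
    bound = ≤-trans (≤-reflexive (∣filter∣-skip P? [ (left a , right b) ] (subst (All _) embeddedEdges≡
              (embeddedEdges-avoid (λ { (_ , (j , lj≡rb)) → left≢right j b lj≡rb })
                                   (λ { ((i , ri≡la) , _) → left≢right a i (sym ri≡la) })))))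
            (length-filter P? [ (left a , right b) ])

  leftClique : AttachedClique G
  leftClique = record
    { size             = n
    ; vertex           = left
    ; vertex-injective = ↑ˡ-injective m _ _
    ; clique           = orderedPairs⇒clique G left ∈-edgesˡ
    ; root             = a
    ; exit             = right b
    ; exit-outside     = λ i → left≢right i b
    ; exitEdge         = proj₁ bridge
    ; exitEdge-joins   = inj₁ (proj₂ bridge)
    ; exitEdge-unique  = bridge-unique
    }

  rightClique : AttachedClique G
  rightClique = record
    { size             = m
    ; vertex           = right
    ; vertex-injective = ↑ʳ-injective n _ _
    ; clique           = orderedPairs⇒clique G right ∈-edgesʳ
    ; root             = b
    ; exit             = left a
    ; exit-outside     = λ j eq → left≢right a j (sym eq)
    ; exitEdge         = proj₁ bridge
    ; exitEdge-joins   = inj₂ (proj₂ bridge)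
    ; exitEdge-unique  = bridge-unique ∘ joins-sym G
    }

  joined : Joined G
  joined = record
    { S            = leftClique
    ; T            = rightClique
    ; disjoint     = left≢right
    ; exits-meet   = inj₁ (refl , refl)
    ; edge-kinds   = edge-kinds
    ; vertex-kinds = vertex-kinds
    }
    where
    edges-kinds : All (λ p → LeftEdge p ⊎ RightEdge p ⊎ p ≡ (left a , right b)) (edges G)
    edges-kinds = ++⁺ (subst (All _) embeddedEdges≡ (All.map (Sum.map₂ inj₁) embeddedEdges-kinds))
                      (inj₂ (inj₂ refl) ∷ [])
    module L = AttachedCliqueProperties G leftClique
    module R = AttachedCliqueProperties G rightClique
    edge-kinds : ∀ e → L.CliqueEdge e ⊎ R.CliqueEdge e ⊎ e ≡ L.exitEdge ⊎ e ≡ R.exitEdge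
    edge-kinds e with All.lookup edges-kinds (∈-lookup e)
    ... | inj₁ leftEdge         = inj₁ leftEdge
    ... | inj₂ (inj₁ rightEdge) = inj₂ (inj₁ rightEdge)
    ... | inj₂ (inj₂ isBridge)  = inj₂ (inj₂ (inj₁ (bridge-unique (inj₁ isBridge))))
    vertex-kinds : ∀ v → L.InClique v ⊎ R.InClique v ⊎ v ≡ L.exit
    vertex-kinds v with splitAt n v in eq
    ... | inj₁ i = inj₁ (i , splitAt⁻¹-↑ˡ eq)
    ... | inj₂ j = inj₂ (inj₁ (j , splitAt⁻¹-↑ʳ eq))

module PathOfLength2 (n m : ℕ) (a : Fin n) (b : Fin m) where

  G : Graph
  G = joinPath2 n m a b

  open TwoCliquesEmbedding {n = n} {m} (_↑ˡ 1)

  middle : Vertex G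
  middle = (n + m) ↑ʳ zero

  left≢right : ∀ i j → left i ≢ right j
  left≢right i j = ↑ˡ≢↑ʳ i j ∘ ↑ˡ-injective 1 _ _

  embedded≢middle : ∀ v → v ↑ˡ 1 ≢ middle
  embedded≢middle v = ↑ˡ≢↑ʳ v zero

  ∈-edgesˡ : ∀ {i j} → toℕ i < toℕ j → (left i , left j) ∈ₗ edges G
  ∈-edgesˡ = ∈-++⁺ˡ ∘ ∈-embeddedEdgesˡ

  ∈-edgesʳ : ∀ {i j} → toℕ i < toℕ j → (right i , right j) ∈ₗ edges G
  ∈-edgesʳ = ∈-++⁺ˡ ∘ ∈-embeddedEdgesʳ

  spokeˡ : ∃[ e ] endpoints G e ≡ (left a , middle)
  spokeˡ = edgeAt G (∈-++⁺ʳ embeddedEdges (here refl))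

  spokeʳ : ∃[ e ] endpoints G e ≡ (right b , middle)
  spokeʳ = edgeAt G (∈-++⁺ʳ embeddedEdges (there (here refl)))

  middle-notEmbedded : ¬ IsLeft middle × ¬ IsRight middle
  middle-notEmbedded = (λ (i , eq) → embedded≢middle _ eq) , (λ (j , eq) → embedded≢middle _ eq)

  spokeˡ-unique : ∀ {e} → Joins G e (left a) middle → e ≡ proj₁ spokeˡ
  spokeˡ-unique joins = uniqueJoiningEdge G bound joins (inj₁ (proj₂ spokeˡ))
    where
    P? = joining? G (left a) middle
    bound : length (filter P? (edges G)) ≤ 1
    bound = ≤-trans (≤-reflexive (∣filter∣-skip P? ((left a , middle) ∷ (right b , middle) ∷ [])
              (embeddedEdges-avoid (proj₁ middle-notEmbedded ∘ proj₂)
                                   (λ ((i , ri≡la) , _) → left≢right a i (sym ri≡la)))))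
            (∣filter[x,y]∣≤1 P? (left a , middle) (right b , middle)
              (inj₂ λ { (inj₁ eq) → left≢right a b (sym (cong proj₁ eq))
                      ; (inj₂ eq) → embedded≢middle _ (cong proj₁ eq) }))

  spokeʳ-unique : ∀ {e} → Joins G e (right b) middle → e ≡ proj₁ spokeʳ
  spokeʳ-unique joins = uniqueJoiningEdge G bound joins (inj₁ (proj₂ spokeʳ))
    where
    P? = joining? G (right b) middle
    bound : length (filter P? (edges G)) ≤ 1
    bound = ≤-trans (≤-reflexive (∣filter∣-skip P? ((left a , middle) ∷ (right b , middle) ∷ [])
              (embeddedEdges-avoid (λ ((i , li≡rb) , _) → left≢right i b li≡rb)
                                   (proj₂ middle-notEmbedded ∘ proj₂))))
            (∣filter[x,y]∣≤1 P? (left a , middle) (right b , middle)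
              (inj₁ λ { (inj₁ eq) → left≢right a b (cong proj₁ eq)
                      ; (inj₂ eq) → embedded≢middle _ (cong proj₁ eq) }))

  leftClique : AttachedClique G
  leftClique = record
    { size             = n
    ; vertex           = left
    ; vertex-injective = ↑ˡ-injective m _ _ ∘ ↑ˡ-injective 1 _ _
    ; clique           = orderedPairs⇒clique G left ∈-edgesˡ
    ; root             = a
    ; exit             = middle
    ; exit-outside     = λ i → embedded≢middle _
    ; exitEdge         = proj₁ spokeˡ
    ; exitEdge-joins   = inj₁ (proj₂ spokeˡ)
    ; exitEdge-unique  = spokeˡ-unique
    }

  rightClique : AttachedClique G
  rightClique = record
    { size             = m
    ; vertex           = right
    ; vertex-injective = ↑ʳ-injective n _ _ ∘ ↑ˡ-injective 1 _ _
    ; clique           = orderedPairs⇒clique G right ∈-edgesʳ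
    ; root             = b
    ; exit             = middle
    ; exit-outside     = λ j → embedded≢middle _
    ; exitEdge         = proj₁ spokeʳ
    ; exitEdge-joins   = inj₁ (proj₂ spokeʳ)
    ; exitEdge-unique  = spokeʳ-unique
    }

  joined : Joined G
  joined = record
    { S            = leftClique
    ; T            = rightClique
    ; disjoint     = left≢right
    ; exits-meet   = inj₂ refl
    ; edge-kinds   = edge-kinds
    ; vertex-kinds = vertex-kinds
    }
    where
    edges-kinds : All (λ p → LeftEdge p ⊎ RightEdge p ⊎ p ≡ (left a , middle) ⊎ p ≡ (right b , middle)) (edges G)
    edges-kinds = ++⁺ (All.map (Sum.map₂ inj₁) embeddedEdges-kinds)
                      (inj₂ (inj₂ (inj₁ refl)) ∷ inj₂ (inj₂ (inj₂ refl)) ∷ [])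
    module L = AttachedCliqueProperties G leftClique
    module R = AttachedCliqueProperties G rightClique
    edge-kinds : ∀ e → L.CliqueEdge e ⊎ R.CliqueEdge e ⊎ e ≡ L.exitEdge ⊎ e ≡ R.exitEdge
    edge-kinds e with All.lookup edges-kinds (∈-lookup e)
    ... | inj₁ leftEdge                = inj₁ leftEdge
    ... | inj₂ (inj₁ rightEdge)        = inj₂ (inj₁ rightEdge)
    ... | inj₂ (inj₂ (inj₁ isSpokeˡ)) = inj₂ (inj₂ (inj₁ (spokeˡ-unique (inj₁ isSpokeˡ))))
    ... | inj₂ (inj₂ (inj₂ isSpokeʳ)) = inj₂ (inj₂ (inj₂ (spokeʳ-unique (inj₁ isSpokeʳ))))
    vertex-kinds : ∀ v → L.InClique v ⊎ R.InClique v ⊎ v ≡ L.exit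
    vertex-kinds v with splitAt (n + m) v in eq
    ... | inj₂ zero = inj₂ (inj₂ (sym (splitAt⁻¹-↑ʳ eq)))
    ... | inj₁ w with splitAt n w in eq′
    ...   | inj₁ i = inj₁ (i , trans (cong (_↑ˡ 1) (splitAt⁻¹-↑ˡ eq′)) (splitAt⁻¹-↑ˡ eq))
    ...   | inj₂ j = inj₂ (inj₁ (j , trans (cong (_↑ˡ 1) (splitAt⁻¹-↑ʳ eq′)) (splitAt⁻¹-↑ˡ eq)))

mainTheorem3 : (n m : ℕ) → 2 < n → 2 < m → (a : Fin n) → (b : Fin m) → (ℓ : PathLength) →
               (g c : ℕ) → IsEdgeDominationNumber (joinGraph ℓ n m a b) g →
               IsEdgeCutDominationNumber (joinGraph ℓ n m a b) c →
               (c ≡ g) ⇔ ((2 ∣ m) ⊎ (2 ∣ n))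
mainTheorem3 n m 2<n 2<m a b len1 g c = cutDomination≡domination⇔even _ (PathOfLength1.joined n m a b) 2<n 2<m
mainTheorem3 n m 2<n 2<m a b len2 g c = cutDomination≡domination⇔even _ (PathOfLength2.joined n m a b) 2<n 2<m
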